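{- Let $G=(\Gamma,s)$ be a graph and $p\in\mathrm{PF}(G)$. Define $V_M(p):=\{v\in\tilde V:p(v)\le\mathrm{mult}(vs)\}$. Then $p$ is prime if and only if, for all $v\in V_M(p)$, the function $p^{v+}:=p+\sum_{w\in\tilde V\setminus\{v\}}\mathrm{mult}(ws)\mathbb 1_w$ belongs to $\mathrm{PF}(G)$.
   Context: A graph $G=(\Gamma,s)$ is a finite, undirected, connected multigraph (multiple edges allowed, no loops) with vertex set $V$ and distinguished sink $s$; $\tilde V=V\setminus\{s\}$. $\mathrm{mult}(vw)$ is the number of edges between $v,w$; $\deg^A(v)=\sum_{w\in A}\mathrm{mult}(vw)$; $\mathbb 1_w$ is the indicator of $w$; $\mathbb N=\{1,2,\dots\}$. For a graph $H$ (not necessarily connected) with sink $s$, vertex set $V_H$, non-sink vertex set $\tilde V_H$, an $H$-parking function is $p:\tilde V_H\to\mathbb N$ such that every non-empty $S\subseteq\tilde V_H$ contains $v$ with $p(v)\le\deg_H^{V_H\setminus S}(v)$; $\mathrm{PF}(H)$ is their set. For $A\subseteq\tilde V$, $G^A$ is the induced subgraph on $A\cup\{s\}$ with sink $s$. For $p\in\mathrm{PF}(G)$ and an ordered partition $(A,B)$ of $\tilde V$ with $A,B\neq\emptyset$, set $p^A=p|_A$ and $p^B(v)=p(v)-\deg^A(v)$ for $v\in B$; $p$ is decomposable w.r.t. $(A,B)$ if $p^A\in\mathrm{PF}(G^A)$ and $p^B\in\mathrm{PF}(G^B)$; $p$ is prime if it is decomposable w.r.t. no such partition. -}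

module Defs where

open import Data.Nat using (ℕ; zero; suc; _+_; _∸_; _≤_)
open import Data.Bool using (Bool; true; false; if_then_else_)
open import Data.Fin using (Fin; zero; suc; _≟_)
open import Data.Fin.Subset using (Subset; _∈_; _⊆_; _─_; ∁; ⊤; Nonempty)
open import Data.Vec using (lookup)
open import Data.Product using (Σ; ∃; _×_)
open import Relation.Binary.PropositionalEquality using (_≡_)
open import Relation.Nullary using (¬_)
open import Relation.Nullary.Decidable using (⌊_⌋)

-- Vertex set V = Fin (suc n); the sink s is the vertex 'zero',
-- the non-sink vertices Ṽ are 'suc i' for i : Fin n.
sink : {n : ℕ} → Fin (suc n)
sink = zero

sumFin : (n : ℕ) → (Fin n → ℕ) → ℕ
sumFin zero    f = 0
sumFin (suc n) f = f zero + sumFin n (λ i → f (suc i))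

data Reach {n : ℕ} (mult : Fin (suc n) → Fin (suc n) → ℕ) (u : Fin (suc n)) :
       Fin (suc n) → Set where
  here : Reach mult u u
  step : ∀ {v w} → Reach mult u v → 1 ≤ mult v w → Reach mult u w

record Graph (n : ℕ) : Set where
  field
    mult      : Fin (suc n) → Fin (suc n) → ℕ
    symmetric : ∀ v w → mult v w ≡ mult w v
    noLoops   : ∀ v → mult v v ≡ 0
    connected : ∀ v → Reach mult sink v

module _ {n : ℕ} (G : Graph n) where
  open Graph G

  degTo : Subset n → Fin (suc n) → ℕ
  degTo A v = sumFin n (λ j → if lookup A j then mult v (suc j) else 0)

  -- For W ⊆ Ṽ, H = G^W (induced on W ∪ {s}, sink s).  For S ⊆ W,
  -- deg_H^{V_H \ S}(v) = mult(v s) + deg^{W \ S}(v).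
  degOut : Subset n → Subset n → Fin n → ℕ
  degOut W S i = mult (suc i) sink + degTo (W ─ S) (suc i)

  -- p ∈ PF(G^W): values of p outside W are irrelevant.
  -- p must take values in ℕ = {1,2,...} on W, and every non-empty S ⊆ W
  -- contains v with p(v) ≤ deg_{G^W}^{V_{G^W} \ S}(v).
  IsPF : Subset n → (Fin n → ℕ) → Set
  IsPF W p = (∀ i → i ∈ W → 1 ≤ p i)
           × (∀ S → S ⊆ W → Nonempty S → ∃ λ i → i ∈ S × p i ≤ degOut W S i)

  PF : (Fin n → ℕ) → Set
  PF p = IsPF ⊤ p

  -- decomposability w.r.t. the ordered partition (A , ∁ A).
  -- p^B(v) = p(v) - deg^A(v); truncated subtraction is harmless since
  -- a value ≤ 0 violates the positivity requirement in IsPF either way.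
  Decomposable : (Fin n → ℕ) → Subset n → Set
  Decomposable p A = IsPF A p × IsPF (∁ A) (λ i → p i ∸ degTo A (suc i))

  Prime : (Fin n → ℕ) → Set
  Prime p = ∀ A → Nonempty A → Nonempty (∁ A) → ¬ Decomposable p A

  InVM : (Fin n → ℕ) → Fin n → Set
  InVM p v = p v ≤ mult (suc v) sink

  plusExcept : (Fin n → ℕ) → Fin n → Fin n → ℕ
  plusExcept p v w = if ⌊ w ≟ v ⌋ then p w else p w + mult (suc w) sink

-- Let p be prime and v ∈ V_M(p).  Call S ⊆ Ṽ blocked if every w ∈ S has
-- p(w) > deg^{Ṽ∖S}(w).  No blocked S avoids v: a maximal such S would make p
-- decomposable w.r.t. (Ṽ∖S , S), because a T ⊆ Ṽ∖S with no parkable vertex in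
-- G^{Ṽ∖S} misses v (as p(v) ≤ mult(vs)) and could be added to S keeping it
-- blocked.  So every S ∌ v has a vertex parking without its sink edges, which
-- p^{v+} pays for, while v itself parks in G.  Conversely, if p decomposes
-- w.r.t. (A , B), applying p^A ∈ PF(G^A) to A gives v ∈ A ∩ V_M(p), and
-- p^{v+} ∈ PF(G) applied to B gives w ∈ B with p(w) ≤ deg^A(w), i.e. p^B(w) = 0.
module Submission where

open import Defs
open import Data.Nat using (ℕ; zero; suc; _+_; _∸_; _≤_; _<_; z≤n; _≤?_)
open import Data.Nat.Properties
  using (≤-refl; ≤-trans; ≤-reflexive; +-mono-≤; +-monoʳ-≤; +-identityʳ; +-comm;
         m≤m+n; m≤n+m; ≤-<-trans; <⇒≱; ≰⇒>; m<n⇒0<n∸m; m≤n⇒m∸n≡0; m≤n+o⇒m∸n≤o;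
         +-cancelˡ-≤; +-commutativeSemigroup; module ≤-Reasoning)
open import Algebra.Properties.CommutativeSemigroup +-commutativeSemigroup using (interchange; x∙yz≈y∙xz)
open import Data.Bool using (true; false; if_then_else_)
open import Data.Fin using (Fin; zero; suc; _≟_)
open import Data.Fin.Subset using (Subset; _∈_; _∉_; _⊆_; _⊂_; _⊃_; _─_; _∪_; ∁; ⊤; Nonempty; Empty)
open import Data.Fin.Subset.Properties
  using (_∈?_; ∈⊤; x∈p∧x∉q⇒x∈p─q; p─q⊆p; x∈∁p⇒x∉p; x∈p⇒x∉∁p; x∉p⇒x∈∁p; x∉∁p⇒x∈p;
         x∈p∪q⁺; x∈p∪q⁻; p⊆p∪q)
open import Data.Fin.Subset.Induction using (Acc; acc; ⊃-wellFounded)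
open import Data.Fin.Properties using (any?)
open import Data.Vec using (_∷_; lookup; here; there)
open import Data.Vec.Properties using ([]=⇒lookup; lookup⇒[]=)
open import Data.Product using (_×_; _,_; ∃; proj₁; proj₂)
open import Data.Sum using (_⊎_; inj₁; inj₂)
open import Data.Empty using (⊥-elim)
open import Relation.Binary.PropositionalEquality using (_≡_; _≢_; refl; sym; trans; subst)
open import Relation.Nullary using (¬_; yes; no; contradiction)
open import Relation.Nullary.Decidable using (_×-dec_)
open import Function using (_∘_)
open import Function.Bundles using (_⇔_; mk⇔)

sumFin-mono : ∀ n {f g : Fin n → ℕ} → (∀ j → f j ≤ g j) → sumFin n f ≤ sumFin n g
sumFin-mono zero    f≤g = z≤n
sumFin-mono (suc n) f≤g = +-mono-≤ (f≤g zero) (sumFin-mono n (λ j → f≤g (suc j)))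

sumFin-+ : ∀ n (f g : Fin n → ℕ) → sumFin n (λ j → f j + g j) ≡ sumFin n f + sumFin n g
sumFin-+ zero    f g = refl
sumFin-+ (suc n) f g
  rewrite sumFin-+ n (λ j → f (suc j)) (λ j → g (suc j)) =
  interchange (f zero) (g zero) (sumFin n (λ j → f (suc j))) (sumFin n (λ j → g (suc j)))

sumFin-zero : ∀ n {f : Fin n → ℕ} → (∀ j → f j ≡ 0) → sumFin n f ≡ 0
sumFin-zero zero    f≡0 = refl
sumFin-zero (suc n) f≡0 rewrite f≡0 zero = sumFin-zero n (λ j → f≡0 (suc j))

module _ {n : ℕ} (A : Subset n) (f : Fin n → ℕ) where

  restrict : Fin n → ℕ
  restrict j = if lookup A j then f j else 0

  restrict-∈ : ∀ {j} → j ∈ A → restrict j ≡ f j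
  restrict-∈ j∈A rewrite []=⇒lookup j∈A = refl

  restrict-∉ : ∀ {j} → j ∉ A → restrict j ≡ 0
  restrict-∉ {j} j∉A with lookup A j in eq
  ... | true  = contradiction (lookup⇒[]= j A eq) j∉A
  ... | false = refl

  -- degTo G A v is definitionally sumOver A (mult v ∘ suc).
  sumOver : ℕ
  sumOver = sumFin n restrict

module _ {n : ℕ} {f : Fin n → ℕ} where

  restrict-⊆∪ : ∀ {A B C : Subset n} j → (j ∈ A → j ∈ B ⊎ j ∈ C) →
                restrict A f j ≤ restrict B f j + restrict C f j
  restrict-⊆∪ {A} {B} {C} j cover with j ∈? A
  ... | no j∉A rewrite restrict-∉ A f j∉A = z≤n
  ... | yes j∈A rewrite restrict-∈ A f j∈A with cover j∈A
  ...   | inj₁ j∈B rewrite restrict-∈ B f j∈B = m≤m+n (f j) _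
  ...   | inj₂ j∈C rewrite restrict-∈ C f j∈C = m≤n+m (f j) _

  restrict-⊆ : ∀ {A B : Subset n} j → (j ∈ A → j ∈ B) → restrict A f j ≤ restrict B f j
  restrict-⊆ {A} {B} j sub with j ∈? A
  ... | no j∉A rewrite restrict-∉ A f j∉A = z≤n
  ... | yes j∈A rewrite restrict-∈ A f j∈A | restrict-∈ B f (sub j∈A) = ≤-refl

  sumOver-mono : ∀ {A B : Subset n} → A ⊆ B → sumOver A f ≤ sumOver B f
  sumOver-mono A⊆B = sumFin-mono n (λ j → restrict-⊆ j A⊆B)

  sumOver-⊆∪ : ∀ {A B C : Subset n} → A ⊆ B ∪ C → sumOver A f ≤ sumOver B f + sumOver C f
  sumOver-⊆∪ {A} {B} {C} A⊆B∪C = begin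
    sumOver A f                                          ≤⟨ sumFin-mono n (λ j → restrict-⊆∪ j (x∈p∪q⁻ B C ∘ A⊆B∪C)) ⟩
    sumFin n (λ j → restrict B f j + restrict C f j)     ≡⟨ sumFin-+ n (restrict B f) (restrict C f) ⟩
    sumOver B f + sumOver C f                            ∎
    where
    open ≤-Reasoning

  sumOver-empty : ∀ {A : Subset n} → Empty A → sumOver A f ≡ 0
  sumOver-empty {A} A-empty = sumFin-zero n (λ j → restrict-∉ A f (λ j∈A → A-empty (j , j∈A)))

x∈p─q⇒x∉q : ∀ {n} {x : Fin n} {p q : Subset n} → x ∈ p ─ q → x ∉ q
x∈p─q⇒x∉q {p = true ∷ p} {q = false ∷ q} here ()
x∈p─q⇒x∉q {p = _ ∷ p} {q = _ ∷ q} (there x∈p─q) (there x∈q) = x∈p─q⇒x∉q x∈p─q x∈q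

x∈⊤─p⇒x∉p : ∀ {n} {x : Fin n} {p : Subset n} → x ∈ ⊤ ─ p → x ∉ p
x∈⊤─p⇒x∉p = x∈p─q⇒x∉q

x∉p⇒x∈⊤─p : ∀ {n} {x : Fin n} {p : Subset n} → x ∉ p → x ∈ ⊤ ─ p
x∉p⇒x∈⊤─p = x∈p∧x∉q⇒x∈p─q ∈⊤

some≤⊎all> : ∀ {n} (S : Subset n) (f g : Fin n → ℕ) →
             (∃ λ w → w ∈ S × f w ≤ g w) ⊎ (∀ w → w ∈ S → g w < f w)
some≤⊎all> S f g with any? (λ w → (w ∈? S) ×-dec (f w ≤? g w))
... | yes (w , w∈S , f≤g) = inj₁ (w , w∈S , f≤g)
... | no ¬some            = inj₂ λ w w∈S → ≰⇒> (λ f≤g → ¬some (w , w∈S , f≤g))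

module _ {n : ℕ} (G : Graph n) where
  open Graph G

  sinkMult : Fin n → ℕ
  sinkMult w = mult (suc w) sink

  deg : Subset n → Fin n → ℕ
  deg A w = degTo G A (suc w)

  deg-mono : ∀ {A B} w → A ⊆ B → deg A w ≤ deg B w
  deg-mono w = sumOver-mono

  deg-⊆∪ : ∀ {A B C} w → A ⊆ B ∪ C → deg A w ≤ deg B w + deg C w
  deg-⊆∪ w = sumOver-⊆∪

  deg-empty : ∀ {A} w → Empty A → deg A w ≡ 0
  deg-empty w = sumOver-empty

  Blocked : (Fin n → ℕ) → Subset n → Set
  Blocked p S = ∀ w → w ∈ S → deg (⊤ ─ S) w < p w

  Unblocked : (Fin n → ℕ) → Subset n → Set
  Unblocked p S = ∃ λ w → w ∈ S × p w ≤ deg (⊤ ─ S) w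

  blocked⇒¬unblocked : ∀ {p S} → Blocked p S → ¬ Unblocked p S
  blocked⇒¬unblocked blocked (w , w∈S , p≤deg) = <⇒≱ (blocked w w∈S) p≤deg

  blocked-∪ : ∀ {p S T} → Blocked p S → T ⊆ ∁ S →
              (∀ w → w ∈ T → degOut G (∁ S) T w < p w) → Blocked p (S ∪ T)
  blocked-∪ {p} {S} {T} S-blocked T⊆∁S T-blocked w w∈S∪T with x∈p∪q⁻ S T w∈S∪T
  ... | inj₁ w∈S = ≤-<-trans (deg-mono w outside-S∪T⊆outside-S) (S-blocked w w∈S)
    where
    outside-S∪T⊆outside-S : ⊤ ─ (S ∪ T) ⊆ ⊤ ─ S
    outside-S∪T⊆outside-S = x∉p⇒x∈⊤─p ∘ (λ x∉S∪T x∈S → x∉S∪T (x∈p∪q⁺ (inj₁ x∈S))) ∘ x∈⊤─p⇒x∉p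
  ... | inj₂ w∈T = ≤-<-trans (≤-trans (deg-mono w outside-S∪T⊆∁S─T) (m≤n+m _ _)) (T-blocked w w∈T)
    where
    outside-S∪T⊆∁S─T : ⊤ ─ (S ∪ T) ⊆ ∁ S ─ T
    outside-S∪T⊆∁S─T x∈ = x∈p∧x∉q⇒x∈p─q (x∉p⇒x∈∁p (x∉S∪T ∘ x∈p∪q⁺ ∘ inj₁)) (x∉S∪T ∘ x∈p∪q⁺ ∘ inj₂)
      where
      x∉S∪T : _ ∉ S ∪ T
      x∉S∪T = x∈⊤─p⇒x∉p x∈

  module _ {p : Fin n → ℕ} (p-PF : PF G p) where

    PF⇒upper-parkable : ∀ A S → Nonempty S →
                        ∃ λ w → w ∈ S × p w ∸ deg A w ≤ degOut G (∁ A) S w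
    PF⇒upper-parkable A S S≢∅ with proj₂ p-PF S (λ _ → ∈⊤) S≢∅
    ... | w , w∈S , p≤ = w , w∈S , m≤n+o⇒m∸n≤o (p w) (deg A w) (begin
      p w                                                  ≤⟨ p≤ ⟩
      sinkMult w + deg (⊤ ─ S) w                           ≤⟨ +-monoʳ-≤ (sinkMult w) (deg-⊆∪ w outside-S⊆A∪[∁A─S]) ⟩
      sinkMult w + (deg A w + deg (∁ A ─ S) w)             ≡⟨ x∙yz≈y∙xz (sinkMult w) (deg A w) _ ⟩
      deg A w + (sinkMult w + deg (∁ A ─ S) w)             ∎)
      where
      open ≤-Reasoning
      outside-S⊆A∪[∁A─S] : ⊤ ─ S ⊆ A ∪ (∁ A ─ S)
      outside-S⊆A∪[∁A─S] {x} x∈ with x ∈? A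
      ... | yes x∈A = x∈p∪q⁺ (inj₁ x∈A)
      ... | no  x∉A = x∈p∪q⁺ (inj₂ (x∈p∧x∉q⇒x∈p─q (x∉p⇒x∈∁p x∉A) (x∈⊤─p⇒x∉p x∈)))

    blocked⇒upper-PF : ∀ {S} → Blocked p S → IsPF G (∁ (∁ S)) (λ i → p i ∸ degTo G (∁ S) (suc i))
    blocked⇒upper-PF {S} S-blocked = positive , λ S′ _ → PF⇒upper-parkable (∁ S) S′
      where
      positive : ∀ i → i ∈ ∁ (∁ S) → 1 ≤ p i ∸ deg (∁ S) i
      positive i i∈∁∁S = m<n⇒0<n∸m (≤-<-trans ∁S≤outside-S (S-blocked i i∈S))
        where
        i∈S : i ∈ S
        i∈S = x∉∁p⇒x∈p (x∈∁p⇒x∉p i∈∁∁S)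
        ∁S≤outside-S : deg (∁ S) i ≤ deg (⊤ ─ S) i
        ∁S≤outside-S = deg-mono {∁ S} {⊤ ─ S} i (x∉p⇒x∈⊤─p ∘ x∈∁p⇒x∉p)

    module _ {v : Fin n} (v∈VM : InVM G p v) where

      blocked⇒lower-PF : ∀ {S} → Blocked p S →
                         (∀ T → T ⊆ ∁ S → Nonempty T → v ∉ T → ¬ Blocked p (S ∪ T)) →
                         IsPF G (∁ S) p
      blocked⇒lower-PF {S} S-blocked maximal = (λ i _ → proj₁ p-PF i ∈⊤) , parkable
        where
        parkable : ∀ T → T ⊆ ∁ S → Nonempty T → ∃ λ w → w ∈ T × p w ≤ degOut G (∁ S) T w
        parkable T T⊆∁S T≢∅ with some≤⊎all> T p (degOut G (∁ S) T)
        ... | inj₁ parked = parked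
        ... | inj₂ T-blocked = contradiction (blocked-∪ S-blocked T⊆∁S T-blocked) (maximal T T⊆∁S T≢∅ v∉T)
          where
          v∉T : v ∉ T
          v∉T v∈T = <⇒≱ (T-blocked v v∈T) (≤-trans v∈VM (m≤m+n _ _))

      prime⇒unblocked : Prime G p → ∀ S → v ∉ S → Nonempty S → Unblocked p S
      prime⇒unblocked prime S = go S (⊃-wellFounded S)
        where
        go : ∀ S → Acc _⊃_ S → v ∉ S → Nonempty S → Unblocked p S
        go S (acc larger) v∉S (s , s∈S) with some≤⊎all> S p (deg (⊤ ─ S))
        ... | inj₁ unblocked = unblocked
        ... | inj₂ S-blocked = ⊥-elim (prime (∁ S) (v , x∉p⇒x∈∁p v∉S) (s , x∉p⇒x∈∁p (x∈p⇒x∉∁p s∈S))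
                                 (blocked⇒lower-PF S-blocked maximal , blocked⇒upper-PF S-blocked))
          where
          maximal : ∀ T → T ⊆ ∁ S → Nonempty T → v ∉ T → ¬ Blocked p (S ∪ T)
          maximal T T⊆∁S (t , t∈T) v∉T S∪T-blocked =
            blocked⇒¬unblocked S∪T-blocked (go (S ∪ T) (larger S⊂S∪T) v∉S∪T (t , t∈S∪T))
            where
            t∈S∪T : t ∈ S ∪ T
            t∈S∪T = x∈p∪q⁺ (inj₂ t∈T)
            S⊂S∪T : S ⊂ S ∪ T
            S⊂S∪T = p⊆p∪q T , t , t∈S∪T , x∈∁p⇒x∉p (T⊆∁S t∈T)
            v∉S∪T : v ∉ S ∪ T
            v∉S∪T v∈S∪T with x∈p∪q⁻ S T v∈S∪T
            ... | inj₁ v∈S = v∉S v∈S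
            ... | inj₂ v∈T = v∉T v∈T

  module _ (p : Fin n → ℕ) (v : Fin n) where

    plusExcept-self : plusExcept G p v v ≡ p v
    plusExcept-self with v ≟ v
    ... | yes _  = refl
    ... | no v≢v = contradiction refl v≢v

    plusExcept-other : ∀ {w} → w ≢ v → plusExcept G p v w ≡ p w + sinkMult w
    plusExcept-other {w} w≢v with w ≟ v
    ... | yes w≡v = contradiction w≡v w≢v
    ... | no _    = refl

    p≤plusExcept : ∀ w → p w ≤ plusExcept G p v w
    p≤plusExcept w with w ≟ v
    ... | yes _ = ≤-refl
    ... | no _  = m≤m+n (p w) (sinkMult w)

  prime⇒plusExcept-PF : ∀ {p} → PF G p → Prime G p → ∀ v → InVM G p v → PF G (plusExcept G p v)
  prime⇒plusExcept-PF {p} p-PF prime v v∈VM =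
    (λ i _ → ≤-trans (proj₁ p-PF i ∈⊤) (p≤plusExcept p v i)) , parkable
    where
    parkable : ∀ S → S ⊆ ⊤ → Nonempty S → ∃ λ w → w ∈ S × plusExcept G p v w ≤ degOut G ⊤ S w
    parkable S _ S≢∅ with v ∈? S
    ... | yes v∈S = v , v∈S , subst (_≤ degOut G ⊤ S v) (sym (plusExcept-self p v)) (≤-trans v∈VM (m≤m+n _ _))
    ... | no  v∉S with prime⇒unblocked p-PF v∈VM prime S v∉S S≢∅
    ...   | w , w∈S , p≤deg = w , w∈S , (begin
      plusExcept G p v w            ≡⟨ plusExcept-other p v w≢v ⟩
      p w + sinkMult w              ≡⟨ +-comm (p w) (sinkMult w) ⟩
      sinkMult w + p w              ≤⟨ +-monoʳ-≤ (sinkMult w) p≤deg ⟩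
      sinkMult w + deg (⊤ ─ S) w    ∎)
      where
      open ≤-Reasoning
      w≢v : w ≢ v
      w≢v refl = v∉S w∈S

  IsPF⇒∃InVM : ∀ {p A} → IsPF G A p → Nonempty A → ∃ λ v → v ∈ A × InVM G p v
  IsPF⇒∃InVM {p} {A} (_ , parkable) A≢∅ with parkable A (λ x∈A → x∈A) A≢∅
  ... | v , v∈A , p≤ = v , v∈A , ≤-trans p≤ (≤-reflexive A─A-contributes-nothing)
    where
    A─A-contributes-nothing : degOut G A A v ≡ sinkMult v
    A─A-contributes-nothing
      rewrite deg-empty {A ─ A} v (λ (x , x∈A─A) → x∈p─q⇒x∉q x∈A─A (p─q⊆p A A x∈A─A)) = +-identityʳ (sinkMult v)

  plusExcept-PF⇒prime : ∀ {p} → (∀ v → InVM G p v → PF G (plusExcept G p v)) → Prime G p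
  plusExcept-PF⇒prime {p} plus-PF A A≢∅ ∁A≢∅ (A-PF , ∁A-PF) with IsPF⇒∃InVM A-PF A≢∅
  ... | v , v∈A , v∈VM with proj₂ (plus-PF v v∈VM) (∁ A) (λ _ → ∈⊤) ∁A≢∅
  ...   | w , w∈∁A , plus≤ = <⇒≱ (proj₁ ∁A-PF w w∈∁A) (≤-reflexive (m≤n⇒m∸n≡0 p≤degA))
    where
    w≢v : w ≢ v
    w≢v refl = x∈∁p⇒x∉p w∈∁A v∈A
    p≤degA : p w ≤ deg A w
    p≤degA = begin
      p w                    ≤⟨ +-cancelˡ-≤ (sinkMult w) (p w) _ (subst (_≤ degOut G ⊤ (∁ A) w) p+m≡m+p plus≤) ⟩
      deg (⊤ ─ ∁ A) w        ≤⟨ deg-mono {⊤ ─ ∁ A} {A} w (x∉∁p⇒x∈p ∘ x∈⊤─p⇒x∉p) ⟩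
      deg A w                ∎
      where
      open ≤-Reasoning
      p+m≡m+p : plusExcept G p v w ≡ sinkMult w + p w
      p+m≡m+p = trans (plusExcept-other p v w≢v) (+-comm (p w) (sinkMult w))

corollary2p12 : (n : ℕ) (G : Graph n) (p : Fin n → ℕ) → PF G p →
    (Prime G p ⇔ (∀ v → InVM G p v → PF G (plusExcept G p v)))
corollary2p12 n G p p-PF = mk⇔ (prime⇒plusExcept-PF G p-PF) (plusExcept-PF⇒prime G)
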